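{- A Cayley permutation $\pi$ is tortoise pop-stack sortable if and only if $\pi$ avoids $231$, $312$, $221$ and $211$.
   Context: A Cayley permutation is a finite word $\pi=\pi_1\cdots\pi_n$ over the positive integers such that every integer from $1$ to $\max(\pi)$ occurs at least once. A word contains a pattern $p=p_1\cdots p_k$ if it has a subsequence $x_{i_1}\cdots x_{i_k}$ with $x_{i_u}<x_{i_v}$ iff $p_u<p_v$ and $x_{i_u}=x_{i_v}$ iff $p_u=p_v$; otherwise it avoids $p$. A tortoise pop-stack processes an input from left to right with a right-greedy algorithm: while the input is nonempty, the next input element is pushed if the resulting stack contents, read from top to bottom, avoid both patterns $21$ and $11$ (i.e. are strictly increasing from top to bottom); otherwise a pop operation is performed, which removes all elements of the stack, appending them to the output in order from top to bottom. When the input is exhausted, the stack is emptied in the same way. $\pi$ is tortoise pop-stack sortable if the output on input $\pi$ is weakly increasing. -}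

module Defs where

open import Data.Nat using (ℕ; _<_; _≤_; _<?_)
open import Data.Nat.Properties using (<-cmp)
open import Data.List using (List; []; _∷_; _++_; length; lookup)
open import Data.List.Membership.Propositional using (_∈_)
open import Data.List.Relation.Unary.All using (All)
open import Data.List.Relation.Unary.Linked using (Linked; linked?)
open import Data.List.Relation.Binary.Sublist.Propositional using (_⊆_)
open import Data.Fin using (Fin; cast)
open import Data.Product using (Σ; ∃; _×_)
open import Relation.Binary.PropositionalEquality using (_≡_)
open import Relation.Nullary using (¬_; yes; no)
open import Function.Bundles using (_⇔_)

maxW : List ℕ → ℕ
maxW [] = 0
maxW (x ∷ xs) = Data.Nat._⊔_ x (maxW xs)

IsCayley : List ℕ → Set
IsCayley w = All (1 ≤_) w × (∀ k → 1 ≤ k → k ≤ maxW w → k ∈ w)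

OrderIso : List ℕ → List ℕ → Set
OrderIso s p = Σ (length s ≡ length p) λ eq → ∀ (u v : Fin (length s)) →
  ((lookup s u < lookup s v) ⇔ (lookup p (cast eq u) < lookup p (cast eq v))) ×
  ((lookup s u ≡ lookup s v) ⇔ (lookup p (cast eq u) ≡ lookup p (cast eq v)))

Contains : List ℕ → List ℕ → Set
Contains w p = ∃ λ s → s ⊆ w × OrderIso s p

Avoids : List ℕ → List ℕ → Set
Avoids w p = ¬ Contains w p

-- Stack contents are listed from top to bottom. Stack contents avoiding
-- both 21 and 11 read top to bottom means strictly increasing top to bottom.
StackOK : List ℕ → Set
StackOK st = Linked _<_ st

tortoise : List ℕ → List ℕ → List ℕ
tortoise st [] = st
tortoise st (x ∷ xs) with linked? _<?_ (x ∷ st)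
... | yes _ = tortoise (x ∷ st) xs
-- pop: output the stack top to bottom and empty it; the input is unchanged,
-- so the next step pushes x onto the empty stack (a single element is always
-- allowed), which we perform immediately.
... | no _ = st ++ tortoise (x ∷ []) xs

tortoiseSort : List ℕ → List ℕ
tortoiseSort w = tortoise [] w

TortoiseSortable : List ℕ → Set
TortoiseSortable w = Linked _≤_ (tortoiseSort w)

-- The machine pushes while the input strictly decreases, so it outputs the maximal
-- strictly decreasing runs of π, each reversed, and the output is sorted iff every run lies
-- weakly below all later letters. From a state with stack top t, stack bottom b and
-- remaining input xs, the rest of the output is sorted exactly when no letter of xs lies
-- in [t, b) and t ∷ xs has no triple a … b … c with c < a and (a ≤ b or b ≤ c).
-- Such triples are precisely the occurrences of 231, 221, 312 and 211.
module Submission where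

open import Defs
open import Data.Nat using (ℕ; _<_; _≤_; _<?_; z<s; s<s)
open import Data.Nat.Properties
  using (<-irrefl; <-asym; <-trans; ≤-refl; ≤-trans; <⇒≤; ≤⇒≯; ≤-reflexive; <-≤-connex; m≤n⇒m<n∨m≡n)
open import Data.List using (List; []; _∷_; _++_)
open import Data.List.Properties using (++-identityʳ)
open import Data.List.Membership.Propositional using (_∈_)
import Data.List.Relation.Unary.Any as Any
open import Data.List.Relation.Unary.All as All using (All; []; _∷_)
open import Data.List.Relation.Unary.Linked as Linked using (Linked; []; [-]; _∷_; linked?)
open import Data.List.Relation.Unary.Linked.Properties using (Linked⇒All)
open import Data.List.Relation.Binary.Sublist.Propositional using (_⊆_; ⊆-refl; ⊆-trans; from∈)
open import Data.List.Relation.Binary.Sublist.Propositional.Properties using (All-resp-⊆)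
open import Data.List.Relation.Binary.Sublist.Heterogeneous using (_∷ʳ_; _∷_)
open import Data.List.Relation.Binary.Permutation.Propositional using (_↭_; ↭-sym; ↭-trans; ↭-reflexive)
open import Data.List.Relation.Binary.Permutation.Propositional.Properties using (All-resp-↭; ++⁺ˡ; shift)
open import Data.Fin using (Fin; zero; suc)
open import Data.Product using (∃-syntax; _×_; _,_; proj₁; proj₂)
open import Data.Product.Function.NonDependent.Propositional using (_×-⇔_)
open import Data.Sum as Sum using (_⊎_; inj₁; inj₂; [_,_]′)
open import Level using (Level)
open import Relation.Binary.Core using (Rel)
open import Relation.Binary.Definitions using (Transitive)
open import Relation.Binary.PropositionalEquality using (_≡_; refl; sym; cong)
open import Relation.Nullary using (¬_; yes; no; contradiction)
open import Function using (_∘_)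
open import Function.Bundles using (_⇔_; mk⇔; Equivalence)
open import Function.Properties.Equivalence using () renaming (refl to ⇔-refl; sym to ⇔-sym; trans to ⇔-trans)
open import Function.Related.Propositional using (module EquationalReasoning)
open import Function.Related.TypeIsomorphisms using (¬-cong-⇔)

lastOf : {A : Set} → A → List A → A
lastOf x [] = x
lastOf _ (y ∷ ys) = lastOf y ys

module _ {A : Set} {ℓ : Level} {R : Rel A ℓ} (trans : Transitive R) where

  Linked-++⇔ : ∀ {x xs ys} → Linked R (x ∷ xs) →
    Linked R ((x ∷ xs) ++ ys) ⇔ (Linked R ys × All (R (lastOf x xs)) ys)
  Linked-++⇔ {x} {xs} {ys} Rxs = mk⇔ (split x xs ys) (join x xs ys Rxs)
    where
    split : ∀ x xs ys → Linked R ((x ∷ xs) ++ ys) → Linked R ys × All (R (lastOf x xs)) ys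
    split x [] [] _ = [] , []
    split x [] (y ∷ ys) (Rxy ∷ Rys) = Rys , Linked⇒All trans Rxy Rys
    split x (z ∷ xs) ys (_ ∷ R++) = split z xs ys R++

    join : ∀ x xs ys → Linked R (x ∷ xs) → Linked R ys × All (R (lastOf x xs)) ys →
      Linked R ((x ∷ xs) ++ ys)
    join x [] [] _ _ = [-]
    join x [] (y ∷ ys) _ (Rys , Rxy ∷ _) = Rxy ∷ Rys
    join x (z ∷ xs) ys (Rxz ∷ Rxs) Rys = Rxz ∷ join z xs ys Rxs Rys

head≤lastOf : ∀ {t st} → Linked _<_ (t ∷ st) → t ≤ lastOf t st
head≤lastOf [-] = ≤-refl
head≤lastOf (t<s ∷ st<) = ≤-trans (<⇒≤ t<s) (head≤lastOf st<)

tortoise-push : ∀ {t st x} xs → x < t → Linked _<_ (t ∷ st) →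
  tortoise (t ∷ st) (x ∷ xs) ≡ tortoise (x ∷ t ∷ st) xs
tortoise-push {t} {st} {x} xs x<t st< with linked? _<?_ (x ∷ t ∷ st)
... | yes _ = refl
... | no ¬st< = contradiction (x<t ∷ st<) ¬st<

tortoise-pop : ∀ {t st x} xs → t ≤ x →
  tortoise (t ∷ st) (x ∷ xs) ≡ (t ∷ st) ++ tortoise (x ∷ []) xs
tortoise-pop {t} {st} {x} xs t≤x with linked? _<?_ (x ∷ t ∷ st)
... | yes st< = contradiction (Linked.head st<) (≤⇒≯ t≤x)
... | no _ = refl

tortoise-↭ : ∀ st xs → tortoise st xs ↭ st ++ xs
tortoise-↭ st [] = ↭-reflexive (sym (++-identityʳ st))
tortoise-↭ st (x ∷ xs) with linked? _<?_ (x ∷ st)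
... | yes _ = ↭-trans (tortoise-↭ (x ∷ st) xs) (↭-sym (shift x st xs))
... | no _ = ++⁺ˡ st (tortoise-↭ (x ∷ []) xs)

All-tortoise⇔ : ∀ {P : ℕ → Set} x xs → All P (tortoise (x ∷ []) xs) ⇔ All P (x ∷ xs)
All-tortoise⇔ x xs = mk⇔ (All-resp-↭ (tortoise-↭ (x ∷ []) xs)) (All-resp-↭ (↭-sym (tortoise-↭ (x ∷ []) xs)))

-- c < a together with a ≤ b is an occurrence of 231 or 221, with b ≤ c one of 312 or 211.
Obstruction : List ℕ → Set
Obstruction w = ∃[ a ] ∃[ b ] ∃[ c ] (a ∷ b ∷ c ∷ []) ⊆ w × c < a × (a ≤ b ⊎ b ≤ c)

obstruction-⊆ : ∀ {xs ys} → xs ⊆ ys → Obstruction xs → Obstruction ys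
obstruction-⊆ xs⊆ys (a , b , c , abc⊆xs , o) = a , b , c , ⊆-trans abc⊆xs xs⊆ys , o

obstruction-∷⁻-minimum : ∀ {t xs} → All (t ≤_) xs → Obstruction (t ∷ xs) → Obstruction xs
obstruction-∷⁻-minimum t≤xs (a , b , c , (_ ∷ʳ abc⊆xs) , o) = a , b , c , abc⊆xs , o
obstruction-∷⁻-minimum t≤xs (_ , b , c , (refl ∷ bc⊆xs) , c<t , _) =
  contradiction c<t (≤⇒≯ (All.head (All.tail (All-resp-⊆ bc⊆xs t≤xs))))

obstruction-lower-head : ∀ {t x xs} → x < t → All (λ c → c < t → c < x) xs →
  Obstruction (t ∷ x ∷ xs) → Obstruction (x ∷ xs)
obstruction-lower-head x<t below (a , b , c , (_ ∷ʳ abc⊆xs) , o) = a , b , c , abc⊆xs , o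
obstruction-lower-head x<t below (_ , _ , c , (refl ∷ refl ∷ c⊆xs) , c<t , inj₁ t≤x) =
  contradiction x<t (≤⇒≯ t≤x)
obstruction-lower-head x<t below (_ , _ , c , (refl ∷ refl ∷ c⊆xs) , c<t , inj₂ x≤c) =
  contradiction (All.head (All-resp-⊆ c⊆xs below) c<t) (≤⇒≯ x≤c)
obstruction-lower-head {x = x} x<t below (_ , b , c , (refl ∷ (_ ∷ʳ bc⊆xs)) , c<t , t≤b⊎b≤c) =
  x , b , c , refl ∷ bc⊆xs , All.head (All.tail (All-resp-⊆ bc⊆xs below)) c<t ,
  Sum.map₁ (≤-trans (<⇒≤ x<t)) t≤b⊎b≤c

Admissible : ℕ → ℕ → List ℕ → Set
Admissible t b xs = ¬ Obstruction (t ∷ xs) × All (λ c → c < t ⊎ b ≤ c) xs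

admissible-self⇔ : ∀ x xs → Admissible x x xs ⇔ (¬ Obstruction (x ∷ xs))
admissible-self⇔ x xs = mk⇔ proj₁ (λ ¬o → ¬o , All.tabulate (λ {c} _ → <-≤-connex c x))

admissible-push⇔ : ∀ {t b x} xs → x < t → t ≤ b → Admissible t b (x ∷ xs) ⇔ Admissible x b xs
admissible-push⇔ {t} {b} {x} xs x<t t≤b = mk⇔ to from
  where
  to : Admissible t b (x ∷ xs) → Admissible x b xs
  to (¬o , _ ∷ split) = (λ o → ¬o (obstruction-⊆ (t ∷ʳ ⊆-refl) o)) , All.tabulate split-x
    where
    split-x : ∀ {c} → c ∈ xs → c < x ⊎ b ≤ c
    split-x {c} c∈xs with All.lookup split c∈xs | <-≤-connex c x
    ... | inj₂ b≤c | _ = inj₂ b≤c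
    ... | inj₁ _ | inj₁ c<x = inj₁ c<x
    ... | inj₁ c<t | inj₂ x≤c = contradiction (t , x , c , refl ∷ refl ∷ from∈ c∈xs , c<t , inj₂ x≤c) ¬o

  from : Admissible x b xs → Admissible t b (x ∷ xs)
  from (¬o , split) =
    (λ o → ¬o (obstruction-lower-head x<t (All.map below split) o)) ,
    inj₁ x<t ∷ All.map (Sum.map₁ (λ c<x → <-trans c<x x<t)) split
    where
    below : ∀ {c} → c < x ⊎ b ≤ c → c < t → c < x
    below (inj₁ c<x) _ = c<x
    below (inj₂ b≤c) c<t = contradiction c<t (≤⇒≯ (≤-trans t≤b b≤c))

admissible-pop⇔ : ∀ {t b x} xs → t ≤ x → t ≤ b →
  Admissible t b (x ∷ xs) ⇔ (¬ Obstruction (x ∷ xs) × All (b ≤_) (x ∷ xs))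
admissible-pop⇔ {t} {b} {x} xs t≤x t≤b = mk⇔ to from
  where
  to : Admissible t b (x ∷ xs) → ¬ Obstruction (x ∷ xs) × All (b ≤_) (x ∷ xs)
  to (¬o , split) = (λ o → ¬o (obstruction-⊆ (t ∷ʳ ⊆-refl) o)) , All.tabulate above
    where
    above : ∀ {c} → c ∈ x ∷ xs → b ≤ c
    above c∈ with All.lookup split c∈
    ... | inj₂ b≤c = b≤c
    above (Any.here refl) | inj₁ x<t = contradiction x<t (≤⇒≯ t≤x)
    above {c} (Any.there c∈xs) | inj₁ c<t =
      contradiction (t , x , c , refl ∷ refl ∷ from∈ c∈xs , c<t , inj₁ t≤x) ¬o

  from : ¬ Obstruction (x ∷ xs) × All (b ≤_) (x ∷ xs) → Admissible t b (x ∷ xs)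
  from (¬o , b≤) =
    (λ o → ¬o (obstruction-∷⁻-minimum (All.map (≤-trans t≤b) b≤) o)) , All.map inj₂ b≤

tortoise-sorts⇔admissible : ∀ t st xs → Linked _<_ (t ∷ st) →
  Linked _≤_ (tortoise (t ∷ st) xs) ⇔ Admissible t (lastOf t st) xs
tortoise-sorts⇔admissible t st [] st< = mk⇔ (λ _ → singleton-free , []) (λ _ → Linked.map <⇒≤ st<)
  where
  singleton-free : ¬ Obstruction (t ∷ [])
  singleton-free (_ , _ , _ , (_ ∷ʳ ()) , _)
  singleton-free (_ , _ , _ , (_ ∷ ()) , _)
tortoise-sorts⇔admissible t st (x ∷ xs) st< with <-≤-connex x t
... | inj₁ x<t = begin
  Linked _≤_ (tortoise (t ∷ st) (x ∷ xs))  ≡⟨ cong (Linked _≤_) (tortoise-push xs x<t st<) ⟩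
  Linked _≤_ (tortoise (x ∷ t ∷ st) xs)    ∼⟨ tortoise-sorts⇔admissible x (t ∷ st) xs (x<t ∷ st<) ⟩
  Admissible x b xs                        ∼⟨ ⇔-sym (admissible-push⇔ xs x<t (head≤lastOf st<)) ⟩
  Admissible t b (x ∷ xs)                  ∎
  where
  open EquationalReasoning
  b : ℕ
  b = lastOf t st
... | inj₂ t≤x = begin
  Linked _≤_ (tortoise (t ∷ st) (x ∷ xs))        ≡⟨ cong (Linked _≤_) (tortoise-pop xs t≤x) ⟩
  Linked _≤_ ((t ∷ st) ++ popped)                ∼⟨ Linked-++⇔ ≤-trans (Linked.map <⇒≤ st<) ⟩
  (Linked _≤_ popped × All (b ≤_) popped)        ∼⟨ restart ×-⇔ All-tortoise⇔ x xs ⟩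
  (¬ Obstruction (x ∷ xs) × All (b ≤_) (x ∷ xs)) ∼⟨ ⇔-sym (admissible-pop⇔ xs t≤x (head≤lastOf st<)) ⟩
  Admissible t b (x ∷ xs)                        ∎
  where
  open EquationalReasoning
  b : ℕ
  b = lastOf t st
  popped : List ℕ
  popped = tortoise (x ∷ []) xs
  restart : Linked _≤_ popped ⇔ (¬ Obstruction (x ∷ xs))
  restart = ⇔-trans (tortoise-sorts⇔admissible x [] xs [-]) (admissible-self⇔ x xs)

sortable⇔obstruction-free : ∀ π → TortoiseSortable π ⇔ (¬ Obstruction π)
sortable⇔obstruction-free [] = mk⇔ (λ _ → λ { (_ , _ , _ , () , _) }) (λ _ → [])
sortable⇔obstruction-free (x ∷ xs) =
  ⇔-trans (tortoise-sorts⇔admissible x [] xs [-]) (admissible-self⇔ x xs)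

SameComparison : ℕ → ℕ → ℕ → ℕ → Set
SameComparison x y u v = (x < y × u < v) ⊎ (x ≡ y × u ≡ v) ⊎ (y < x × v < u)

sameComparison-refl : ∀ {x u} → SameComparison x x u u
sameComparison-refl = inj₂ (inj₁ (refl , refl))

sameComparison-sym : ∀ {x y u v} → SameComparison x y u v → SameComparison y x v u
sameComparison-sym (inj₁ lt) = inj₂ (inj₂ lt)
sameComparison-sym (inj₂ (inj₁ (x≡y , u≡v))) = inj₂ (inj₁ (sym x≡y , sym u≡v))
sameComparison-sym (inj₂ (inj₂ gt)) = inj₁ gt

sameComparison⇒⇔ : ∀ {x y u v} → SameComparison x y u v → (x < y ⇔ u < v) × (x ≡ y ⇔ u ≡ v)
sameComparison⇒⇔ (inj₁ (x<y , u<v)) =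
  mk⇔ (λ _ → u<v) (λ _ → x<y) ,
  mk⇔ (λ x≡y → contradiction x<y (<-irrefl x≡y)) (λ u≡v → contradiction u<v (<-irrefl u≡v))
sameComparison⇒⇔ (inj₂ (inj₁ (x≡y , u≡v))) =
  mk⇔ (λ x<y → contradiction x<y (<-irrefl x≡y)) (λ u<v → contradiction u<v (<-irrefl u≡v)) ,
  mk⇔ (λ _ → u≡v) (λ _ → x≡y)
sameComparison⇒⇔ (inj₂ (inj₂ (y<x , v<u))) =
  mk⇔ (λ x<y → contradiction x<y (<-asym y<x)) (λ u<v → contradiction u<v (<-asym v<u)) ,
  mk⇔ (λ x≡y → contradiction y<x (<-irrefl (sym x≡y))) (λ u≡v → contradiction v<u (<-irrefl (sym u≡v)))

orderIso₃ : ∀ {a b c p q r} →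
  SameComparison a b p q → SameComparison a c p r → SameComparison b c q r →
  OrderIso (a ∷ b ∷ c ∷ []) (p ∷ q ∷ r ∷ [])
orderIso₃ ab ac bc = refl , λ where
  zero zero → sameComparison⇒⇔ sameComparison-refl
  zero (suc zero) → sameComparison⇒⇔ ab
  zero (suc (suc zero)) → sameComparison⇒⇔ ac
  (suc zero) zero → sameComparison⇒⇔ (sameComparison-sym ab)
  (suc zero) (suc zero) → sameComparison⇒⇔ sameComparison-refl
  (suc zero) (suc (suc zero)) → sameComparison⇒⇔ bc
  (suc (suc zero)) zero → sameComparison⇒⇔ (sameComparison-sym ac)
  (suc (suc zero)) (suc zero) → sameComparison⇒⇔ (sameComparison-sym bc)
  (suc (suc zero)) (suc (suc zero)) → sameComparison⇒⇔ sameComparison-refl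

contains₃ : ∀ {w p q r} → Contains w (p ∷ q ∷ r ∷ []) →
  ∃[ a ] ∃[ b ] ∃[ c ] (a ∷ b ∷ c ∷ []) ⊆ w × OrderIso (a ∷ b ∷ c ∷ []) (p ∷ q ∷ r ∷ [])
contains₃ ((a ∷ b ∷ c ∷ []) , abc⊆w , iso) = a , b , c , abc⊆w , iso
contains₃ ([] , _ , () , _)
contains₃ ((_ ∷ []) , _ , () , _)
contains₃ ((_ ∷ _ ∷ []) , _ , () , _)
contains₃ ((_ ∷ _ ∷ _ ∷ _ ∷ _) , _ , () , _)

Patterns : List ℕ → Set
Patterns w = Contains w (2 ∷ 3 ∷ 1 ∷ []) ⊎ Contains w (3 ∷ 1 ∷ 2 ∷ []) ⊎
             Contains w (2 ∷ 2 ∷ 1 ∷ []) ⊎ Contains w (2 ∷ 1 ∷ 1 ∷ [])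

obstruction⇔patterns : ∀ w → Obstruction w ⇔ Patterns w
obstruction⇔patterns w = mk⇔ to from
  where
  i₀ i₁ i₂ : Fin 3
  i₀ = zero
  i₁ = suc zero
  i₂ = suc (suc zero)

  <-from : ∀ {A B C D : Set} → (A ⇔ B) × (C ⇔ D) → B → A
  <-from = Equivalence.from ∘ proj₁

  ≡-from : ∀ {A B C D : Set} → (A ⇔ B) × (C ⇔ D) → D → C
  ≡-from = Equivalence.from ∘ proj₂

  to : Obstruction w → Patterns w
  to (a , b , c , abc⊆w , c<a , inj₁ a≤b) with m≤n⇒m<n∨m≡n a≤b
  ... | inj₁ a<b = inj₁ (_ , abc⊆w ,
    orderIso₃ (inj₁ (a<b , s<s (s<s z<s))) (inj₂ (inj₂ (c<a , s<s z<s)))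
              (inj₂ (inj₂ (<-trans c<a a<b , s<s z<s))))
  ... | inj₂ refl = inj₂ (inj₂ (inj₁ (_ , abc⊆w ,
    orderIso₃ sameComparison-refl (inj₂ (inj₂ (c<a , s<s z<s))) (inj₂ (inj₂ (c<a , s<s z<s))))))
  to (a , b , c , abc⊆w , c<a , inj₂ b≤c) with m≤n⇒m<n∨m≡n b≤c
  ... | inj₁ b<c = inj₂ (inj₁ (_ , abc⊆w ,
    orderIso₃ (inj₂ (inj₂ (<-trans b<c c<a , s<s z<s))) (inj₂ (inj₂ (c<a , s<s (s<s z<s))))
              (inj₁ (b<c , s<s z<s))))
  ... | inj₂ refl = inj₂ (inj₂ (inj₂ (_ , abc⊆w ,
    orderIso₃ (inj₂ (inj₂ (c<a , s<s z<s))) (inj₂ (inj₂ (c<a , s<s z<s))) sameComparison-refl)))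

  from : Patterns w → Obstruction w
  from (inj₁ p) with contains₃ p
  ... | a , b , c , abc⊆w , refl , cmp =
    a , b , c , abc⊆w , <-from (cmp i₂ i₀) (s<s z<s) , inj₁ (<⇒≤ (<-from (cmp i₀ i₁) (s<s (s<s z<s))))
  from (inj₂ (inj₁ p)) with contains₃ p
  ... | a , b , c , abc⊆w , refl , cmp =
    a , b , c , abc⊆w , <-from (cmp i₂ i₀) (s<s (s<s z<s)) , inj₂ (<⇒≤ (<-from (cmp i₁ i₂) (s<s z<s)))
  from (inj₂ (inj₂ (inj₁ p))) with contains₃ p
  ... | a , b , c , abc⊆w , refl , cmp =
    a , b , c , abc⊆w , <-from (cmp i₂ i₀) (s<s z<s) , inj₁ (≤-reflexive (≡-from (cmp i₀ i₁) refl))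
  from (inj₂ (inj₂ (inj₂ p))) with contains₃ p
  ... | a , b , c , abc⊆w , refl , cmp =
    a , b , c , abc⊆w , <-from (cmp i₂ i₀) (s<s z<s) , inj₂ (≤-reflexive (≡-from (cmp i₁ i₂) refl))

¬⊎⇔¬×¬ : {A B : Set} → (¬ (A ⊎ B)) ⇔ (¬ A × ¬ B)
¬⊎⇔¬×¬ = mk⇔ (λ ¬a⊎b → ¬a⊎b ∘ inj₁ , ¬a⊎b ∘ inj₂) (λ (¬a , ¬b) → [ ¬a , ¬b ]′)

theorem10 : (π : List ℕ) → IsCayley π →
    TortoiseSortable π ⇔
      (Avoids π (2 ∷ 3 ∷ 1 ∷ []) × Avoids π (3 ∷ 1 ∷ 2 ∷ []) ×
       Avoids π (2 ∷ 2 ∷ 1 ∷ []) × Avoids π (2 ∷ 1 ∷ 1 ∷ []))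
theorem10 π _ = begin
  TortoiseSortable π  ∼⟨ sortable⇔obstruction-free π ⟩
  ¬ Obstruction π     ∼⟨ ¬-cong-⇔ (obstruction⇔patterns π) ⟩
  ¬ Patterns π        ∼⟨ ⇔-trans ¬⊎⇔¬×¬ (⇔-refl ×-⇔ ⇔-trans ¬⊎⇔¬×¬ (⇔-refl ×-⇔ ¬⊎⇔¬×¬)) ⟩
  (Avoids π (2 ∷ 3 ∷ 1 ∷ []) × Avoids π (3 ∷ 1 ∷ 2 ∷ []) ×
   Avoids π (2 ∷ 2 ∷ 1 ∷ []) × Avoids π (2 ∷ 1 ∷ 1 ∷ []))  ∎
  where open EquationalReasoning
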